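{- Let $k\geq 3$, $n_1,\dots,n_k\geq 2$ and $r\in\{1,\dots,k\}$, and let $CS^r_{n_1,\dots,n_k}$ be the clique-star with cliques of sizes $n_1,\dots,n_k$ and center clique of index $r$ (on a labeled vertex set). Then $$|\mathcal{O}(CS^r_{n_1,\dots,n_k})| = \sum_{\substack{I\subseteq[k]\\ |I|\text{ odd}}}\ \prod_{i\in I} n_i \;+\; \sum_{j=1}^k \prod_{i\in[k]\setminus\{j\}}(n_i+1),$$ where $[k]=\{1,\dots,k\}$.
   Context: Local complement $c_v(G)$: replace the subgraph induced on the neighbourhood of vertex $v$ by its complement, leaving all other edges unchanged. The LC orbit $\mathcal{O}(G)$ is the set of labeled graphs on the vertex set of $G$ obtainable from $G$ by finite sequences of local complements (labeled graphs counted as distinct even if isomorphic). The clique-star $CS^r_{n_1,\dots,n_k}$ has vertex set $U_1\sqcup\cdots\sqcup U_k$ with $|U_i|=n_i$; each $U_i$ is a clique, every vertex of $U_r$ is adjacent to every vertex of every $U_i$ ($i\neq r$), and there are no edges between $U_i$ and $U_j$ for distinct $i,j\neq r$. -}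

module Defs where

open import Data.Nat using (ℕ; zero; suc; _+_; _*_)
open import Data.Bool using (Bool; true; false; not; _∧_; _∨_; _xor_; if_then_else_; T?)
open import Data.Fin using (Fin; zero; suc)
open import Data.Fin.Properties using () renaming (_≟_ to _≟F_)
open import Data.Fin.Subset using (Subset; ∣_∣)
open import Data.Vec using (Vec; []; _∷_; lookup)
open import Data.List using (List; []; _∷_; map; _++_; length; filter)
open import Data.List.Relation.Unary.All using (All)
open import Data.List.Relation.Unary.Any using (Any)
open import Data.List.Relation.Unary.AllPairs using (AllPairs)
open import Data.Product using (Σ; _,_; _×_; ∃)
open import Data.Product.Properties using (≡-dec)
open import Relation.Binary.PropositionalEquality using (_≡_; refl)
open import Relation.Binary.Definitions using (DecidableEquality)
open import Relation.Nullary using (¬_; does; yes; no)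

Graph : Set → Set
Graph V = V → V → Bool

_≐_ : {V : Set} → Graph V → Graph V → Set
G ≐ H = ∀ u w → G u w ≡ H u w

lc : {V : Set} → DecidableEquality V → V → Graph V → Graph V
lc _≟_ v G a b = if does (a ≟ b) then G a b else (G a b xor (G a v ∧ G b v))

data Reachable {V : Set} (eq : DecidableEquality V) (G : Graph V) : Graph V → Set where
  here : Reachable eq G G
  step : ∀ {H} → Reachable eq G H → (v : V) → Reachable eq G (lc eq v H)

OrbitSize : {V : Set} → DecidableEquality V → Graph V → ℕ → Set
OrbitSize {V} eq G m =
  Σ (List (Graph V)) λ L →
    AllPairs (λ H H′ → ¬ (H ≐ H′)) L
    × All (Reachable eq G) L
    × (∀ H → Reachable eq G H → Any (λ H′ → H ≐ H′) L)
    × length L ≡ m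

CSVertex : (k : ℕ) → (Fin k → ℕ) → Set
CSVertex k n = Σ (Fin k) (λ i → Fin (n i))

csEq : (k : ℕ) (n : Fin k → ℕ) → DecidableEquality (CSVertex k n)
csEq k n = ≡-dec _≟F_ _≟F_

cliqueStar : (k : ℕ) (n : Fin k → ℕ) (r : Fin k) → Graph (CSVertex k n)
cliqueStar k n r (i , a) (j , b) with i ≟F j
... | yes refl = not (does (a ≟F b))
... | no _     = does (i ≟F r) ∨ does (j ≟F r)

sumFin : (k : ℕ) → (Fin k → ℕ) → ℕ
sumFin zero f = 0
sumFin (suc k) f = f zero + sumFin k (λ i → f (suc i))

prodFin : (k : ℕ) → (Fin k → ℕ) → ℕ
prodFin zero f = 1
prodFin (suc k) f = f zero * prodFin k (λ i → f (suc i))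

allSubsets : (k : ℕ) → List (Subset k)
allSubsets zero = [] ∷ []
allSubsets (suc k) = map (true ∷_) (allSubsets k) ++ map (false ∷_) (allSubsets k)

isOdd : ℕ → Bool
isOdd zero = false
isOdd (suc m) = not (isOdd m)

sumList : List ℕ → ℕ
sumList [] = 0
sumList (x ∷ xs) = x + sumList xs

prodSubset : (k : ℕ) → (Fin k → ℕ) → Subset k → ℕ
prodSubset k n I = prodFin k (λ i → if lookup I i then n i else 1)

oddSubsetSum : (k : ℕ) → (Fin k → ℕ) → ℕ
oddSubsetSum k n =
  sumList (map (prodSubset k n) (filter (λ I → T? (isOdd ∣ I ∣)) (allSubsets k)))

leaveOneOut : (k : ℕ) → (Fin k → ℕ) → ℕ
leaveOneOut k n =
  sumFin k (λ j → prodFin k (λ i → if does (i ≟F j) then 1 else suc (n i)))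

module Submission where

-- Every graph in the LC orbit of the clique-star has the following form: inside each clique it
-- is complete, empty or a star, and between two linked cliques it is complete bipartite on
-- their exposed vertices (the whole clique, or the centre of its star). A local complementation
-- acts on such a description clique by clique (⟦⟧-lc): the clique of the pivot becomes a star
-- at the pivot or stops being one, cliques linked to it swap complete and empty, and the links
-- are locally complemented at the pivot's clique. Normalising the description leaves two kinds
-- of graphs: all cliques linked, with a set I of stars of odd size, or all cliques linked to a
-- centre j only, the centre being complete or empty according to the parity of the number of
-- stars. Every such graph is reached from the clique-star, distinct normal forms give distinct
-- graphs because k ≥ 3 and every n_i ≥ 2, and there are ∏_{i∈I} n_i graphs of the first kind
-- for each odd I and ∏_{i≠j} (n_i + 1) of the second kind for each centre j.

open import Defs

open import Data.Bool using (Bool; true; false; not; _∧_; _∨_; _xor_; if_then_else_; T?)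
open import Data.Bool.Properties
  using (T-≡; ∨-comm; ∨-zeroʳ; ∧-identityʳ; ∧-zeroʳ; xor-identityʳ; xor-assoc)
open import Data.Bool.Solver using (module xor-∧-Solver)
open import Data.Empty using (⊥; ⊥-elim)
open import Data.Fin using (Fin; zero; suc; fromℕ<; punchIn; punchOut)
open import Data.Fin.Properties
  using (suc-injective; punchInᵢ≢i; punchIn-injective; punchIn-punchOut) renaming (_≟_ to _≟F_)
open import Data.Fin.Subset using (Subset; ∣_∣)
open import Data.List using (List; []; _∷_; [_]; map; _++_; length; concatMap; allFin; tabulate; filter)
open import Data.List.Properties using (length-++; length-map; map-cong; length-tabulate; map-tabulate)
open import Data.List.Membership.Propositional using (_∈_)
open import Data.List.Membership.Propositional.Properties
  using (∈-allFin; ∈-map⁻; ∈-map⁺; ∈-filter⁺; ∈-filter⁻)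
open import Data.List.Relation.Unary.All using (All; []; _∷_)
import Data.List.Relation.Unary.All as All
import Data.List.Relation.Unary.All.Properties as AllP
open import Data.List.Relation.Unary.AllPairs using (AllPairs; []; _∷_)
import Data.List.Relation.Unary.AllPairs as AllPairs
import Data.List.Relation.Unary.AllPairs.Properties as AllPairsP
open import Data.List.Relation.Unary.Any using (Any; here; there)
import Data.List.Relation.Unary.Any as Any
import Data.List.Relation.Unary.Any.Properties as AnyP
open import Data.List.Relation.Unary.Unique.Propositional.Properties using (allFin⁺)
open import Data.Maybe using (Maybe; just; nothing; is-just; fromMaybe)
open import Data.Maybe.Properties using (≡-dec; just-injective)
open import Data.Nat using (ℕ; zero; suc; _+_; _*_; _≤_; s≤s)
open import Data.Nat.Properties using (<⇒≤)
open import Data.Product using (Σ; _,_; _×_; proj₁; proj₂)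
open import Data.Sum using (_⊎_; inj₁; inj₂)
open import Data.Vec using ([]; _∷_; lookup)
import Data.Vec as Vec
open import Data.Vec.Properties using (∷-injectiveʳ)
import Data.Vec.Properties as VecP
open import Function using (_∘_; id; case_of_)
open import Function.Bundles using (Equivalence)
open import Level using (0ℓ)
open import Relation.Binary.Core using (Rel)
open import Relation.Binary.Definitions using (DecidableEquality)
open import Relation.Binary.PropositionalEquality
  using (_≡_; _≢_; refl; sym; trans; cong; cong₂; subst; module ≡-Reasoning)
open import Relation.Nullary using (¬_; Dec; yes; no; does)
open import Relation.Nullary.Decidable using (dec-true; dec-false)

_≋_ : ∀ {m} {A : Fin m → Set} (f g : (i : Fin m) → A i) → Set
f ≋ g = ∀ i → f i ≡ g i

infix 7 _==_
_==_ : ∀ {m} → Fin m → Fin m → Bool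
a == b = does (a ≟F b)

module _ {m : ℕ} where

  ==-refl : (a : Fin m) → (a == a) ≡ true
  ==-refl a = dec-true (a ≟F a) refl

  ≢⇒==-false : {a b : Fin m} → a ≢ b → (a == b) ≡ false
  ≢⇒==-false = dec-false (_ ≟F _)

  ==⇒≡ : {a b : Fin m} → (a == b) ≡ true → a ≡ b
  ==⇒≡ {a} {b} a==b with a ≟F b
  ... | yes a≡b = a≡b

module _ {m : ℕ} {A : Fin m → Set} where

  infixl 6 _[_]≔_
  _[_]≔_ : ((i : Fin m) → A i) → (i : Fin m) → A i → (l : Fin m) → A l
  (f [ i ]≔ x) l with l ≟F i
  ... | yes refl = x
  ... | no  _    = f l

  []≔-updated : ∀ f i (x : A i) → (f [ i ]≔ x) i ≡ x
  []≔-updated f i x with i ≟F i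
  ... | yes refl = refl
  ... | no  i≢i  = ⊥-elim (i≢i refl)

  []≔-other : ∀ f i (x : A i) {l} → l ≢ i → (f [ i ]≔ x) l ≡ f l
  []≔-other f i x {l} l≢i with l ≟F i
  ... | yes l≡i = ⊥-elim (l≢i l≡i)
  ... | no  _   = refl

  []≔-agree : ∀ {f g : (i : Fin m) → A i} {i x} →
              x ≡ g i → (∀ l → l ≢ i → f l ≡ g l) → (f [ i ]≔ x) ≋ g
  []≔-agree {i = i} x≡gi agree l with l ≟F i
  ... | yes refl = x≡gi
  ... | no  l≢i  = agree l l≢i

Fin-another : ∀ {m} → 2 ≤ m → (x : Fin m) → Σ (Fin m) (_≢ x)
Fin-another (s≤s (s≤s _)) x = punchIn x zero , punchInᵢ≢i x zero

Fin-third : ∀ {m} → 3 ≤ m → (a b : Fin m) → Σ (Fin m) λ c → c ≢ a × c ≢ b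
Fin-third (s≤s (s≤s (s≤s _))) a b with a ≟F b
... | yes refl = punchIn a zero , punchInᵢ≢i a zero , punchInᵢ≢i a zero
... | no  a≢b  = punchIn a b′ , punchInᵢ≢i a b′ ,
                 λ c≡b → punchInᵢ≢i (punchOut a≢b) zero
                           (punchIn-injective a _ _ (trans c≡b (sym (punchIn-punchOut a≢b))))
  where
  b′ = punchIn (punchOut a≢b) zero

-- Lists and finite products

module _ {A : Set} where

  AllPairs-map-local : ∀ {P : A → Set} {R S : Rel A 0ℓ} {xs} → All P xs →
                       (∀ {x y} → P x → P y → R x y → S x y) → AllPairs R xs → AllPairs S xs
  AllPairs-map-local []         f []           = []
  AllPairs-map-local (px ∷ pxs) f (Rxs ∷ Rxss) =
    All.zipWith (λ (py , Rxy) → f px py Rxy) (pxs , Rxs) ∷ AllPairs-map-local pxs f Rxss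

module _ {A B : Set} where

  All-concatMap⁺ : ∀ {P : B → Set} (f : A → List B) {xs} →
                   (∀ {x} → x ∈ xs → All P (f x)) → All P (concatMap f xs)
  All-concatMap⁺ f h = AllP.concat⁺ (AllP.map⁺ (All.tabulate h))

  AllPairs-concatMap⁺ : ∀ {R : Rel A 0ℓ} {S : Rel B 0ℓ} (f : A → List B) {xs} →
    (∀ x → AllPairs S (f x)) →
    (∀ {x y} → R x y → All (λ b → All (S b) (f y)) (f x)) →
    AllPairs R xs → AllPairs S (concatMap f xs)
  AllPairs-concatMap⁺ f unique cross Rxs =
    AllPairsP.concat⁺ (AllP.map⁺ (All.universal unique _)) (AllPairsP.map⁺ (AllPairs.map cross Rxs))

  length-concatMap : (f : A → List B) (xs : List A) →
                     length (concatMap f xs) ≡ sumList (map (length ∘ f) xs)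
  length-concatMap f []       = refl
  length-concatMap f (x ∷ xs) =
    trans (length-++ (f x)) (cong (length (f x) +_) (length-concatMap f xs))

  length-concatMap-const : (f : A → List B) (c : ℕ) → (∀ x → length (f x) ≡ c) →
                           (xs : List A) → length (concatMap f xs) ≡ length xs * c
  length-concatMap-const f c len-f []       = refl
  length-concatMap-const f c len-f (x ∷ xs) =
    trans (length-++ (f x)) (cong₂ _+_ (len-f x) (length-concatMap-const f c len-f xs))

module _ {m : ℕ} {A : Fin (suc m) → Set} where

  infixr 5 _∷ᵈ_
  _∷ᵈ_ : A zero → ((i : Fin m) → A (suc i)) → (i : Fin (suc m)) → A i
  (x ∷ᵈ f) zero    = x
  (x ∷ᵈ f) (suc i) = f i

choices : ∀ {m} {A : Fin m → Set} → ((i : Fin m) → List (A i)) → List ((i : Fin m) → A i)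
choices {zero}  L = [ (λ ()) ]
choices {suc m} L = concatMap (λ x → map (x ∷ᵈ_) (choices (L ∘ suc))) (L zero)

length-choices : ∀ {m} {A : Fin m → Set} (L : (i : Fin m) → List (A i)) →
                 length (choices L) ≡ prodFin m (length ∘ L)
length-choices {zero}  L = refl
length-choices {suc m} {A} L =
  trans (length-concatMap-const _ (length (choices (L ∘ suc)))
          (λ x → length-map (_∷ᵈ_ {A = A} x) (choices (L ∘ suc))) (L zero))
        (cong (length (L zero) *_) (length-choices (L ∘ suc)))

choices-sound : ∀ {m} {A : Fin m → Set} (L : (i : Fin m) → List (A i)) →
                All (λ f → ∀ i → f i ∈ L i) (choices L)
choices-sound {zero}  L = (λ ()) ∷ []
choices-sound {suc m} L = All-concatMap⁺ _ λ x∈ →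
  AllP.map⁺ (All.map (λ f∈ → λ { zero → x∈ ; (suc i) → f∈ i }) (choices-sound (L ∘ suc)))

choices-complete : ∀ {m} {A : Fin m → Set} (L : (i : Fin m) → List (A i)) (f : (i : Fin m) → A i) →
                   (∀ i → f i ∈ L i) → Any (f ≋_) (choices L)
choices-complete {zero}  L f f∈ = here (λ ())
choices-complete {suc m} L f f∈ = AnyP.concatMap⁺ _ (Any.map (λ { refl → AnyP.map⁺ (Any.map
  (λ f≋g → λ { zero → refl ; (suc i) → f≋g i }) (choices-complete (L ∘ suc) (f ∘ suc) (f∈ ∘ suc))) })
  (f∈ zero))

choices-unique : ∀ {m} {A : Fin m → Set} (L : (i : Fin m) → List (A i)) →
                 (∀ i → AllPairs _≢_ (L i)) → AllPairs (λ f g → ¬ f ≋ g) (choices L)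
choices-unique {zero}  L unique = [] ∷ []
choices-unique {suc m} L unique = AllPairs-concatMap⁺ _
  (λ x → AllPairsP.map⁺ (AllPairs.map (λ f≉g x∷f≋x∷g → f≉g (x∷f≋x∷g ∘ suc))
                                       (choices-unique (L ∘ suc) (unique ∘ suc))))
  (λ x≢y → AllP.map⁺ (All.universal (λ _ → AllP.map⁺ (All.universal (λ _ e → x≢y (e zero)) _)) _))
  (unique zero)

allSubsets-complete : ∀ {m} (I : Subset m) → I ∈ allSubsets m
allSubsets-complete []          = here refl
allSubsets-complete (true ∷ I)  = AnyP.++⁺ˡ (AnyP.map⁺ (Any.map (cong (true ∷_)) (allSubsets-complete I)))
allSubsets-complete {suc m} (false ∷ I) =
  AnyP.++⁺ʳ (map (true ∷_) (allSubsets m)) (AnyP.map⁺ (Any.map (cong (false ∷_)) (allSubsets-complete I)))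

allSubsets-unique : ∀ m → AllPairs _≢_ (allSubsets m)
allSubsets-unique zero    = [] ∷ []
allSubsets-unique (suc m) =
  AllPairsP.++⁺ (AllPairsP.map⁺ (AllPairs.map (λ I≢J → I≢J ∘ ∷-injectiveʳ) (allSubsets-unique m)))
                (AllPairsP.map⁺ (AllPairs.map (λ I≢J → I≢J ∘ ∷-injectiveʳ) (allSubsets-unique m)))
                (AllP.map⁺ (All.universal (λ _ → AllP.map⁺ (All.universal (λ _ ()) _)) _))

prodFin-cong : ∀ {m} {f g : Fin m → ℕ} → f ≋ g → prodFin m f ≡ prodFin m g
prodFin-cong {zero}  f≋g = refl
prodFin-cong {suc m} f≋g = cong₂ _*_ (f≋g zero) (prodFin-cong (f≋g ∘ suc))

sumList-tabulate : ∀ {m} (f : Fin m → ℕ) → sumList (tabulate f) ≡ sumFin m f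
sumList-tabulate {zero}  f = refl
sumList-tabulate {suc m} f = cong (f zero +_) (sumList-tabulate (f ∘ suc))

∧-distribˡ-∧ : ∀ Q x y → Q ∧ (x ∧ y) ≡ (Q ∧ x) ∧ (Q ∧ y)
∧-distribˡ-∧ false x y = refl
∧-distribˡ-∧ true  x y = refl

parity : ∀ {m} → (Fin m → Bool) → Bool
parity {zero}  f = false
parity {suc m} f = f zero xor parity (f ∘ suc)

parity-cong : ∀ {m} {f g : Fin m → Bool} → f ≋ g → parity f ≡ parity g
parity-cong {zero}  f≋g = refl
parity-cong {suc m} f≋g = cong₂ _xor_ (f≋g zero) (parity-cong (f≋g ∘ suc))

parity-update : ∀ {m} (f g : Fin m → Bool) i → (∀ l → l ≢ i → f l ≡ g l) →
                parity g ≡ parity f xor (f i xor g i)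
parity-update f g zero agree rewrite parity-cong {f = g ∘ suc} {g = f ∘ suc} (λ l → sym (agree (suc l) λ ())) =
  solve 3 (λ g₀ f₀ P → g₀ :+ P := (f₀ :+ P) :+ (f₀ :+ g₀)) refl (g zero) (f zero) (parity (f ∘ suc))
  where open xor-∧-Solver using (solve; _:+_; _:=_)
parity-update f g (suc i) agree
  rewrite agree zero (λ ())
        | parity-update (f ∘ suc) (g ∘ suc) i (λ l l≢i → agree (suc l) (l≢i ∘ suc-injective)) =
  sym (xor-assoc (g zero) _ _)

parity-false : ∀ m → parity {m} (λ _ → false) ≡ false
parity-false zero    = refl
parity-false (suc m) = parity-false m

parity-lookup : ∀ {m} (I : Subset m) → parity (lookup I) ≡ isOdd ∣ I ∣
parity-lookup []          = refl
parity-lookup (true ∷ I)  = cong not (parity-lookup I)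
parity-lookup (false ∷ I) = parity-lookup I

-- Local complementation

module _ {V : Set} where

  ≐-sym : {G H : Graph V} → G ≐ H → H ≐ G
  ≐-sym G≐H u w = sym (G≐H u w)

  ≐-trans : {G H I : Graph V} → G ≐ H → H ≐ I → G ≐ I
  ≐-trans G≐H H≐I u w = trans (G≐H u w) (H≐I u w)

  separatedBy : ∀ {G H : Graph V} u w → G u w ≡ true → H u w ≡ false → ¬ G ≐ H
  separatedBy u w Guw Huw G≐H with () ← trans (sym Guw) (trans (G≐H u w) Huw)

  module _ (eq : DecidableEquality V) where

    lc-cong : {G H : Graph V} → G ≐ H → ∀ v → lc eq v G ≐ lc eq v H
    lc-cong G≐H v u w rewrite G≐H u w | G≐H u v | G≐H w v = refl

    lc-atMostOneNeighbour : (G : Graph V) (v : V) →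
                            (∀ u w → G u v ≡ true → G w v ≡ true → u ≡ w) → lc eq v G ≐ G
    lc-atMostOneNeighbour G v unique u w with eq u w
    ... | yes _ = refl
    ... | no u≢w with G u v in uv | G w v in wv
    ...   | true  | true  = ⊥-elim (u≢w (unique u w uv wv))
    ...   | true  | false = xor-identityʳ _
    ...   | false | _     = xor-identityʳ _

module _ {V : Set} (eq : DecidableEquality V) (G : Graph V) {L : Set} (⟦_⟧ : L → Graph V) where

  Realised : L → Set
  Realised l = Σ (Graph V) λ H → Reachable eq G H × H ≐ ⟦ l ⟧

  private
    representatives : {ls : List L} → All Realised ls → List (Graph V)
    representatives = All.reduce proj₁

    representatives-distinct : {ls : List L} (rs : All Realised ls) →
      AllPairs (λ l l′ → ¬ ⟦ l ⟧ ≐ ⟦ l′ ⟧) ls →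
      AllPairs (λ H H′ → ¬ H ≐ H′) (representatives rs)
    representatives-distinct []       []               = []
    representatives-distinct (r ∷ rs) (l≉ls ∷ distinct) = head r rs l≉ls ∷ representatives-distinct rs distinct
      where
      head : ∀ {l ls} (r : Realised l) (rs : All Realised ls) → All (λ l′ → ¬ ⟦ l ⟧ ≐ ⟦ l′ ⟧) ls →
             All (λ H′ → ¬ proj₁ r ≐ H′) (representatives rs)
      head r [] [] = []
      head r@(_ , _ , H≐l) ((_ , _ , H′≐l′) ∷ rs) (l≉l′ ∷ l≉ls) =
        (λ H≐H′ → l≉l′ (≐-trans (≐-sym H≐l) (≐-trans H≐H′ H′≐l′))) ∷ head r rs l≉ls

    representatives-reachable : {ls : List L} (rs : All Realised ls) → All (Reachable eq G) (representatives rs)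
    representatives-reachable []                     = []
    representatives-reachable ((_ , reach , _) ∷ rs) = reach ∷ representatives-reachable rs

    representatives-cover : ∀ {H} {ls : List L} (rs : All Realised ls) →
      Any (λ l → H ≐ ⟦ l ⟧) ls → Any (H ≐_) (representatives rs)
    representatives-cover ((_ , _ , H′≐l) ∷ rs) (here H≐l) = here (≐-trans H≐l (≐-sym H′≐l))
    representatives-cover (_ ∷ rs)              (there H∈) = there (representatives-cover rs H∈)

    length-representatives : {ls : List L} (rs : All Realised ls) → length (representatives rs) ≡ length ls
    length-representatives []       = refl
    length-representatives (_ ∷ rs) = cong suc (length-representatives rs)

  orbitSize-fromLabels : {ls : List L} → All Realised ls →
    AllPairs (λ l l′ → ¬ ⟦ l ⟧ ≐ ⟦ l′ ⟧) ls →
    (∀ H → Reachable eq G H → Any (λ l → H ≐ ⟦ l ⟧) ls) →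
    OrbitSize eq G (length ls)
  orbitSize-fromLabels rs distinct complete =
    representatives rs , representatives-distinct rs distinct , representatives-reachable rs ,
    (λ H reach → representatives-cover rs (complete H reach)) , length-representatives rs

-- Clique states

data CliqueState (m : ℕ) : Set where
  complete empty : CliqueState m
  star           : Fin m → CliqueState m

module _ {m : ℕ} where

  adjacentIn : CliqueState m → Fin m → Fin m → Bool
  adjacentIn complete a b = not (a == b)
  adjacentIn empty    a b = false
  adjacentIn (star x) a b = not (a == b) ∧ (a == x ∨ b == x)

  -- The vertices of the clique that carry its edges to the other cliques.
  exposed : CliqueState m → Fin m → Bool
  exposed (star x) a = a == x
  exposed _        a = true

  -- The state after a local complementation at an exposed vertex a of the clique (lcInside), or
  -- at an outside vertex (lcOutside, the flag telling whether it is adjacent to the exposed part).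
  lcInside : Fin m → CliqueState m → CliqueState m
  lcInside a complete = star a
  lcInside a empty    = empty
  lcInside a (star _) = complete

  lcOutside : Bool → CliqueState m → CliqueState m
  lcOutside false s        = s
  lcOutside true  complete = empty
  lcOutside true  empty    = complete
  lcOutside true  (star x) = star x

  adjacentIn-irrefl : (s : CliqueState m) (a : Fin m) → adjacentIn s a a ≡ false
  adjacentIn-irrefl complete a rewrite ==-refl a = refl
  adjacentIn-irrefl empty    a = refl
  adjacentIn-irrefl (star x) a rewrite ==-refl a = refl

  exposed-lcOutside : ∀ Q (s : CliqueState m) b → exposed (lcOutside Q s) b ≡ exposed s b
  exposed-lcOutside false s        b = refl
  exposed-lcOutside true  complete b = refl
  exposed-lcOutside true  empty    b = refl
  exposed-lcOutside true  (star x) b = refl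

  adjacentIn-lcOutside : ∀ Q (s : CliqueState m) {b c} → b ≢ c →
    adjacentIn (lcOutside Q s) b c ≡ adjacentIn s b c xor (Q ∧ exposed s b ∧ exposed s c)
  adjacentIn-lcOutside false s        b≢c = sym (xor-identityʳ _)
  adjacentIn-lcOutside true  complete b≢c rewrite ≢⇒==-false b≢c = refl
  adjacentIn-lcOutside true  empty    b≢c rewrite ≢⇒==-false b≢c = refl
  adjacentIn-lcOutside true  (star x) {b} {c} b≢c rewrite ≢⇒==-false b≢c with b == x in b==x | c == x in c==x
  ... | true  | true  = ⊥-elim (b≢c (trans (==⇒≡ b==x) (sym (==⇒≡ c==x))))
  ... | true  | false = refl
  ... | false | true  = refl
  ... | false | false = refl

  adjacentIn-lcInside : ∀ (s : CliqueState m) {a b c} → exposed s a ≡ true → b ≢ c →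
    adjacentIn (lcInside a s) b c ≡ adjacentIn s b c xor (adjacentIn s b a ∧ adjacentIn s c a)
  adjacentIn-lcInside complete {a} {b} {c} _ b≢c rewrite ≢⇒==-false b≢c with b == a | c == a
  ... | true  | true  = refl
  ... | true  | false = refl
  ... | false | true  = refl
  ... | false | false = refl
  adjacentIn-lcInside empty    _ _ = refl
  adjacentIn-lcInside (star x) {a} {b} {c} a==x b≢c with ==⇒≡ {a = a} {b = x} a==x
  ... | refl rewrite ≢⇒==-false b≢c | ==-refl a with b == a | c == a
  ...   | true  | true  = refl
  ...   | true  | false = refl
  ...   | false | true  = refl
  ...   | false | false = refl

  exposed-lcInside : ∀ (s : CliqueState m) {a} b → exposed s a ≡ true →
    exposed (lcInside a s) b ≡ exposed s b xor adjacentIn s b a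
  exposed-lcInside complete {a} b _ with b == a
  ... | true  = refl
  ... | false = refl
  exposed-lcInside empty    b _ = refl
  exposed-lcInside (star x) {a} b a==x with ==⇒≡ {a = a} {b = x} a==x
  ... | refl rewrite ==-refl a with b == a
  ...   | true  = refl
  ...   | false = refl

  hidden⇒star : (s : CliqueState m) {a : Fin m} → exposed s a ≡ false →
                Σ (Fin m) λ x → s ≡ star x × (a == x) ≡ false
  hidden⇒star (star x) a==x = x , refl , a==x

  star-neighbour : ∀ {x a b : Fin m} → (a == x) ≡ false → adjacentIn (star x) b a ≡ true → b ≡ x
  star-neighbour {x} {a} {b} a≠x adj rewrite a≠x with b == a | b == x in b==x
  ... | false | true = ==⇒≡ b==x

  pointed : CliqueState m → Maybe (Fin m) → CliqueState m
  pointed s nothing  = s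
  pointed s (just x) = star x

  toggle : Fin m → Maybe (Fin m) → Maybe (Fin m)
  toggle a nothing  = just a
  toggle a (just _) = nothing

  exposedBy : Maybe (Fin m) → Fin m → Bool
  exposedBy nothing  _ = true
  exposedBy (just x) z = z == x

  exposed-pointed-empty : ∀ x z → exposed (pointed empty x) z ≡ exposedBy x z
  exposed-pointed-empty nothing  z = refl
  exposed-pointed-empty (just x) z = refl

  exposed-pointed-complete : ∀ x z → exposed (pointed complete x) z ≡ exposedBy x z
  exposed-pointed-complete nothing  z = refl
  exposed-pointed-complete (just x) z = refl

  lcOutside-pointed-empty : (x : Maybe (Fin m)) → lcOutside true (pointed empty x) ≡ pointed complete x
  lcOutside-pointed-empty nothing  = refl
  lcOutside-pointed-empty (just x) = refl

  lcOutside-pointed-complete : (x : Maybe (Fin m)) → lcOutside true (pointed complete x) ≡ pointed empty x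
  lcOutside-pointed-complete nothing  = refl
  lcOutside-pointed-complete (just x) = refl

  lcInside-pointed-complete : (x : Maybe (Fin m)) {a : Fin m} → exposed (pointed complete x) a ≡ true →
                              lcInside a (pointed complete x) ≡ pointed complete (toggle a x)
  lcInside-pointed-complete nothing  _ = refl
  lcInside-pointed-complete (just x) _ = refl

module CliqueStarOrbit (k : ℕ) (n : Fin k → ℕ) where

  V : Set
  V = CSVertex k n

  eqV : DecidableEquality V
  eqV = csEq k n

  -- Graphs described clique by clique; every graph of the orbit has this form.
  record Shape : Set where
    constructor shape
    field
      state  : (i : Fin k) → CliqueState (n i)
      linked : Fin k → Fin k → Bool
  open Shape public

  ⟦_⟧ : Shape → Graph V
  ⟦ R ⟧ (i , a) (j , b) with i ≟F j
  ... | yes refl = adjacentIn (state R i) a b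
  ... | no _     = linked R i j ∧ exposed (state R i) a ∧ exposed (state R j) b

  ⟦⟧-within : ∀ R i (a b : Fin (n i)) → ⟦ R ⟧ (i , a) (i , b) ≡ adjacentIn (state R i) a b
  ⟦⟧-within R i a b with i ≟F i
  ... | yes refl = refl
  ... | no  i≢i  = ⊥-elim (i≢i refl)

  ⟦⟧-across : ∀ R {i j} (a : Fin (n i)) (b : Fin (n j)) → i ≢ j →
              ⟦ R ⟧ (i , a) (j , b) ≡ linked R i j ∧ exposed (state R i) a ∧ exposed (state R j) b
  ⟦⟧-across R {i} {j} a b i≢j with i ≟F j
  ... | yes i≡j = ⊥-elim (i≢j i≡j)
  ... | no  _   = refl

  ⟦⟧-toHidden : ∀ R {i j} (b : Fin (n j)) (a : Fin (n i)) → j ≢ i → exposed (state R i) a ≡ false →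
                ⟦ R ⟧ (j , b) (i , a) ≡ false
  ⟦⟧-toHidden R b a j≢i hidden
    rewrite ⟦⟧-across R b a j≢i | hidden | ∧-zeroʳ (exposed (state R _) b) = ∧-zeroʳ _

  ⟦⟧-irrefl : ∀ R u → ⟦ R ⟧ u u ≡ false
  ⟦⟧-irrefl R (i , a) = trans (⟦⟧-within R i a a) (adjacentIn-irrefl (state R i) a)

  Symmetric : Shape → Set
  Symmetric R = ∀ i j → linked R i j ≡ linked R j i

  infix 4 _≅_
  _≅_ : Shape → Shape → Set
  R ≅ R′ = (∀ i → state R i ≡ state R′ i) × (∀ i j → i ≢ j → linked R i j ≡ linked R′ i j)

  ≅-refl : ∀ {R} → R ≅ R
  ≅-refl = (λ _ → refl) , (λ _ _ _ → refl)

  ⟦⟧-cong : ∀ {R R′} → R ≅ R′ → ⟦ R ⟧ ≐ ⟦ R′ ⟧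
  ⟦⟧-cong {R} {R′} (states , links) (i , a) (j , b) with i ≟F j
  ... | yes refl rewrite states i = refl
  ... | no  i≢j  rewrite states i | states j | links i j i≢j = refl

  lcAt : (i : Fin k) → Fin (n i) → Shape → Shape
  state (lcAt i a R) l with l ≟F i
  ... | yes refl = lcInside a (state R l)
  ... | no  _    = lcOutside (linked R i l) (state R l)
  linked (lcAt i a R) j l =
    if j == i ∨ l == i then linked R j l else linked R j l xor (linked R j i ∧ linked R l i)

  lcShape : V → Shape → Shape
  lcShape (i , a) R = if exposed (state R i) a then lcAt i a R else R

  state-lcAt-pivot : ∀ i a R → state (lcAt i a R) i ≡ lcInside a (state R i)
  state-lcAt-pivot i a R with i ≟F i
  ... | yes refl = refl
  ... | no  i≢i  = ⊥-elim (i≢i refl)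

  state-lcAt-other : ∀ i a R {l} → l ≢ i → state (lcAt i a R) l ≡ lcOutside (linked R i l) (state R l)
  state-lcAt-other i a R {l} l≢i with l ≟F i
  ... | yes l≡i = ⊥-elim (l≢i l≡i)
  ... | no  _   = refl

  module _ (R : Shape) (symmetric : Symmetric R) (i : Fin k) (a : Fin (n i))
           (a-exposed : exposed (state R i) a ≡ true) where

    private
      v : V
      v = (i , a)

      R′ : Shape
      R′ = lcAt i a R

      toPivot : ∀ {j} (b : Fin (n j)) → j ≢ i → ⟦ R ⟧ (j , b) v ≡ linked R j i ∧ exposed (state R j) b
      toPivot b j≢i rewrite ⟦⟧-across R b a j≢i | a-exposed = cong (linked R _ i ∧_) (∧-identityʳ _)

    lc-within-pivot : ∀ {b c : Fin (n i)} → b ≢ c →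
      ⟦ R ⟧ (i , b) (i , c) xor (⟦ R ⟧ (i , b) v ∧ ⟦ R ⟧ (i , c) v) ≡ ⟦ R′ ⟧ (i , b) (i , c)
    lc-within-pivot {b} {c} b≢c
      rewrite ⟦⟧-within R i b c | ⟦⟧-within R i b a | ⟦⟧-within R i c a
            | ⟦⟧-within R′ i b c | state-lcAt-pivot i a R =
      sym (adjacentIn-lcInside (state R i) a-exposed b≢c)

    lc-within-other : ∀ {j} {b c : Fin (n j)} → j ≢ i → b ≢ c →
      ⟦ R ⟧ (j , b) (j , c) xor (⟦ R ⟧ (j , b) v ∧ ⟦ R ⟧ (j , c) v) ≡ ⟦ R′ ⟧ (j , b) (j , c)
    lc-within-other {j} {b} {c} j≢i b≢c
      rewrite ⟦⟧-within R j b c | toPivot b j≢i | toPivot c j≢i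
            | ⟦⟧-within R′ j b c | state-lcAt-other i a R j≢i
            | adjacentIn-lcOutside (linked R i j) (state R j) b≢c | symmetric i j =
      cong (adjacentIn (state R j) b c xor_) (sym (∧-distribˡ-∧ (linked R j i) _ _))

    open xor-∧-Solver using (solve; _:+_; _:*_; _:=_)

    lc-across-pivot : ∀ {l} (b : Fin (n i)) (c : Fin (n l)) → l ≢ i →
      ⟦ R ⟧ (i , b) (l , c) xor (⟦ R ⟧ (i , b) v ∧ ⟦ R ⟧ (l , c) v) ≡ ⟦ R′ ⟧ (i , b) (l , c)
    lc-across-pivot {l} b c l≢i
      rewrite ⟦⟧-across R b c (l≢i ∘ sym) | ⟦⟧-within R i b a | toPivot c l≢i
            | ⟦⟧-across R′ b c (l≢i ∘ sym) | state-lcAt-pivot i a R | state-lcAt-other i a R l≢i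
            | exposed-lcInside (state R i) b a-exposed | exposed-lcOutside (linked R i l) (state R l) c
            | ==-refl i | symmetric l i =
      solve 4 (λ Q eb ec t → (Q :* (eb :* ec)) :+ (t :* (Q :* ec)) := Q :* ((eb :+ t) :* ec)) refl
        (linked R i l) (exposed (state R i) b) (exposed (state R l) c) (adjacentIn (state R i) b a)

    lc-across-toPivot : ∀ {j} (b : Fin (n j)) (c : Fin (n i)) → j ≢ i →
      ⟦ R ⟧ (j , b) (i , c) xor (⟦ R ⟧ (j , b) v ∧ ⟦ R ⟧ (i , c) v) ≡ ⟦ R′ ⟧ (j , b) (i , c)
    lc-across-toPivot {j} b c j≢i
      rewrite ⟦⟧-across R b c j≢i | toPivot b j≢i | ⟦⟧-within R i c a
            | ⟦⟧-across R′ b c j≢i | state-lcAt-pivot i a R | state-lcAt-other i a R j≢i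
            | exposed-lcInside (state R i) c a-exposed | exposed-lcOutside (linked R i j) (state R j) b
            | ≢⇒==-false j≢i | ==-refl i =
      solve 4 (λ Q eb ec t → (Q :* (eb :* ec)) :+ ((Q :* eb) :* t) := Q :* (eb :* (ec :+ t))) refl
        (linked R j i) (exposed (state R j) b) (exposed (state R i) c) (adjacentIn (state R i) c a)

    lc-across-others : ∀ {j l} (b : Fin (n j)) (c : Fin (n l)) → j ≢ i → l ≢ i → j ≢ l →
      ⟦ R ⟧ (j , b) (l , c) xor (⟦ R ⟧ (j , b) v ∧ ⟦ R ⟧ (l , c) v) ≡ ⟦ R′ ⟧ (j , b) (l , c)
    lc-across-others {j} {l} b c j≢i l≢i j≢l
      rewrite ⟦⟧-across R b c j≢l | toPivot b j≢i | toPivot c l≢i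
            | ⟦⟧-across R′ b c j≢l | state-lcAt-other i a R j≢i | state-lcAt-other i a R l≢i
            | exposed-lcOutside (linked R i j) (state R j) b | exposed-lcOutside (linked R i l) (state R l) c
            | ≢⇒==-false j≢i | ≢⇒==-false l≢i =
      solve 5 (λ Q Qj Ql eb ec → (Q :* (eb :* ec)) :+ ((Qj :* eb) :* (Ql :* ec))
                                 := (Q :+ (Qj :* Ql)) :* (eb :* ec)) refl
        (linked R j l) (linked R j i) (linked R l i) (exposed (state R j) b) (exposed (state R l) c)

    lc-exposed : lc eqV v ⟦ R ⟧ ≐ ⟦ R′ ⟧
    lc-exposed u w with eqV u w
    ... | yes refl = trans (⟦⟧-irrefl R u) (sym (⟦⟧-irrefl R′ u))
    lc-exposed u@(j , b) w@(l , c) | no u≢w = pairs (j ≟F l) (j ≟F i) (l ≟F i)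
      where
      pairs : Dec (j ≡ l) → Dec (j ≡ i) → Dec (l ≡ i) →
              ⟦ R ⟧ u w xor (⟦ R ⟧ u v ∧ ⟦ R ⟧ w v) ≡ ⟦ R′ ⟧ u w
      pairs (yes refl) (yes refl) _ = lc-within-pivot (λ b≡c → u≢w (cong (i ,_) b≡c))
      pairs (yes refl) (no j≢i)   _ = lc-within-other j≢i (λ b≡c → u≢w (cong (j ,_) b≡c))
      pairs (no j≢l) (yes refl) (yes refl) = ⊥-elim (j≢l refl)
      pairs (no j≢l) (yes refl) (no l≢i)   = lc-across-pivot b c l≢i
      pairs (no j≢l) (no j≢i)   (yes refl) = lc-across-toPivot b c j≢i
      pairs (no j≢l) (no j≢i)   (no l≢i)   = lc-across-others b c j≢i l≢i j≢l

  -- A hidden vertex of a star has the centre as its only neighbour.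
  lc-hidden : ∀ R i (a : Fin (n i)) → exposed (state R i) a ≡ false → lc eqV (i , a) ⟦ R ⟧ ≐ ⟦ R ⟧
  lc-hidden R i a hidden with hidden⇒star (state R i) hidden
  ... | x , star-x , a≠x = lc-atMostOneNeighbour eqV ⟦ R ⟧ (i , a)
    λ u w u∼a w∼a → trans (neighbour u u∼a) (sym (neighbour w w∼a))
    where
    neighbour : ∀ u → ⟦ R ⟧ u (i , a) ≡ true → u ≡ (i , x)
    neighbour (j , b) b∼a = byClique (j ≟F i)
      where
      byClique : Dec (j ≡ i) → (j , b) ≡ (i , x)
      byClique (yes refl) = cong (j ,_) (star-neighbour a≠x (subst (λ s → adjacentIn s b a ≡ true) star-x
                                           (trans (sym (⟦⟧-within R j b a)) b∼a)))
      byClique (no j≢i) with () ← trans (sym b∼a) (⟦⟧-toHidden R b a j≢i hidden)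

  ⟦⟧-lc : ∀ R → Symmetric R → ∀ v → lc eqV v ⟦ R ⟧ ≐ ⟦ lcShape v R ⟧
  ⟦⟧-lc R symmetric (i , a) with exposed (state R i) a in e
  ... | true  = lc-exposed R symmetric i a e
  ... | false = lc-hidden R i a e

  -- Labels

  Pointing : Set
  Pointing = (i : Fin k) → Maybe (Fin (n i))

  parityOf : Pointing → Bool
  parityOf c = parity (is-just ∘ c)

  centreState : ∀ {m} → Pointing → CliqueState m
  centreState c = if parityOf c then empty else complete

  -- Normal forms of the orbit graphs, each clique carrying an optional mark: either all cliques
  -- are linked, or only to a centre clique j.
  data Label : Set where
    uncentred : Pointing → Label
    centred   : Fin k → Pointing → Label

  shapeOf : Label → Shape
  shapeOf (uncentred c) = shape (λ i → pointed empty (c i)) (λ _ _ → true)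
  shapeOf (centred j c) = shape (λ i → if i == j then centreState c else pointed complete (c i))
                                (λ i l → i == j ∨ l == j)

  state-centred-centre : ∀ j c → state (shapeOf (centred j c)) j ≡ centreState c
  state-centred-centre j c = cong (if_then centreState c else pointed complete (c j)) (==-refl j)

  state-centred-other : ∀ {i j} c → i ≢ j → state (shapeOf (centred j c)) i ≡ pointed complete (c i)
  state-centred-other {i} c i≢j = cong (if_then centreState c else pointed complete (c i)) (≢⇒==-false i≢j)

  graphOf : Label → Graph V
  graphOf p = ⟦ shapeOf p ⟧

  -- The marked vertex of the centre clique is irrelevant, and uncentred labels of even parity
  -- lie outside the orbit.
  Canonical : Label → Set
  Canonical (uncentred c) = parityOf c ≡ true
  Canonical (centred j c) = c j ≡ nothing

  infix 4 _≈_
  _≈_ : Label → Label → Set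
  uncentred c ≈ uncentred c′ = c ≋ c′
  centred j c ≈ centred j′ c′ = j ≡ j′ × c ≋ c′
  _           ≈ _            = ⊥

  shapeOf-symmetric : ∀ p → Symmetric (shapeOf p)
  shapeOf-symmetric (uncentred c) i l = refl
  shapeOf-symmetric (centred j c) i l = ∨-comm (i == j) (l == j)

  centreState-cong : ∀ {m} {c c′ : Pointing} → c ≋ c′ → centreState {m} c ≡ centreState c′
  centreState-cong c≋c′ = cong (if_then empty else complete) (parity-cong (cong is-just ∘ c≋c′))

  centreState-none : ∀ {m} → centreState {m} (λ _ → nothing) ≡ complete
  centreState-none = cong (if_then empty else complete) (parity-false k)

  ≈⇒≅ : ∀ p q → p ≈ q → shapeOf p ≅ shapeOf q
  ≈⇒≅ (uncentred c) (uncentred c′) c≋c′ = (λ i → cong (pointed empty) (c≋c′ i)) , (λ _ _ _ → refl)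
  ≈⇒≅ (centred j c) (centred .j c′) (refl , c≋c′) = states , (λ _ _ _ → refl)
    where
    states : ∀ i → state (shapeOf (centred j c)) i ≡ state (shapeOf (centred j c′)) i
    states i rewrite centreState-cong {n i} c≋c′ | c≋c′ i = refl

  moveCentred : (j : Fin k) → Pointing → ∀ {i} → Fin (n i) → Dec (i ≡ j) → Label
  moveCentred j c {i} a (yes refl) = uncentred (if parityOf c then c else c [ i ]≔ just a)
  moveCentred j c {i} a (no _)     = centred j (c [ i ]≔ toggle a (c i))

  moveExposed : Label → (i : Fin k) → Fin (n i) → Label
  moveExposed (uncentred c) i a = centred i (c [ i ]≔ nothing)
  moveExposed (centred j c) i a = moveCentred j c a (i ≟F j)

  move : Label → V → Label
  move p (i , a) = if exposed (state (shapeOf p) i) a then moveExposed p i a else p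

  move-exposed : ∀ p {i} {a : Fin (n i)} → exposed (state (shapeOf p) i) a ≡ true →
                 move p (i , a) ≡ moveExposed p i a
  move-exposed p a-exposed rewrite a-exposed = refl

  exposed-centreState : ∀ {m} c (a : Fin m) → exposed (centreState c) a ≡ true
  exposed-centreState c a with parityOf c
  ... | true  = refl
  ... | false = refl

  parityOf-update : ∀ c i x → parityOf (c [ i ]≔ x) ≡ parityOf c xor (is-just (c i) xor is-just x)
  parityOf-update c i x =
    trans (parity-update (is-just ∘ c) (is-just ∘ (c [ i ]≔ x)) i
                         (λ l l≢i → cong is-just (sym ([]≔-other c i x l≢i))))
          (cong (λ y → parityOf c xor (is-just (c i) xor is-just y)) ([]≔-updated c i x))

  module _ (c : Pointing) (i : Fin k) (a : Fin (n i)) where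

    lcAt-uncentred : parityOf c ≡ true → exposed (pointed empty (c i)) a ≡ true →
                     lcAt i a (shapeOf (uncentred c)) ≅ shapeOf (centred i (c [ i ]≔ nothing))
    lcAt-uncentred odd a-exposed = states , links
      where
      states : ∀ l → state (lcAt i a (shapeOf (uncentred c))) l ≡ state (shapeOf (centred i (c [ i ]≔ nothing))) l
      states l with l ≟F i
      ... | no  l≢i = lcOutside-pointed-empty (c l)
      ... | yes refl rewrite parityOf-update c l nothing | odd with c l
      ...   | nothing = refl
      ...   | just x  = refl
      links : ∀ j l → j ≢ l → linked (lcAt i a (shapeOf (uncentred c))) j l ≡ (j == i ∨ l == i)
      links j l _ with j == i ∨ l == i
      ... | true  = refl
      ... | false = refl

  module _ (j : Fin k) (c : Pointing) where

    lcAt-centred-centre : (a : Fin (n j)) → c j ≡ nothing →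
      lcAt j a (shapeOf (centred j c)) ≅ shapeOf (uncentred (if parityOf c then c else c [ j ]≔ just a))
    lcAt-centred-centre a cj≡nothing = states , links
      where
      states : ∀ l → state (lcAt j a (shapeOf (centred j c))) l
                   ≡ state (shapeOf (uncentred (if parityOf c then c else c [ j ]≔ just a))) l
      states l with l ≟F j | parityOf c
      ... | yes refl | true  rewrite ==-refl l | cj≡nothing = refl
      ... | yes refl | false rewrite ==-refl l | []≔-updated c l (just a) = refl
      ... | no  l≢j  | true  rewrite ==-refl j | ≢⇒==-false l≢j = lcOutside-pointed-complete (c l)
      ... | no  l≢j  | false rewrite ==-refl j | ≢⇒==-false l≢j | []≔-other c j (just a) l≢j =
        lcOutside-pointed-complete (c l)
      links : ∀ j′ l → j′ ≢ l → linked (lcAt j a (shapeOf (centred j c))) j′ l ≡ true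
      links j′ l _ rewrite ==-refl j with j′ == j | l == j
      ... | true  | _     = refl
      ... | false | true  = refl
      ... | false | false = refl

    lcAt-centred-other : ∀ {i} (a : Fin (n i)) → i ≢ j → exposed (pointed complete (c i)) a ≡ true →
      lcAt i a (shapeOf (centred j c)) ≅ shapeOf (centred j (c [ i ]≔ toggle a (c i)))
    lcAt-centred-other {i} a i≢j a-exposed = states , links
      where
      c′ = c [ i ]≔ toggle a (c i)
      centre-flips : parityOf c′ ≡ parityOf c xor true
      centre-flips rewrite parityOf-update c i (toggle a (c i)) with c i
      ... | nothing = refl
      ... | just _  = refl
      states : ∀ l → state (lcAt i a (shapeOf (centred j c))) l ≡ state (shapeOf (centred j c′)) l
      states l with l ≟F i
      ... | yes refl rewrite ≢⇒==-false i≢j = lcInside-pointed-complete (c l) a-exposed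
      ... | no  l≢i  with l ≟F j
      ...   | yes refl rewrite ≢⇒==-false i≢j | centre-flips with parityOf c
      ...     | true  = refl
      ...     | false = refl
      states l | no l≢i | no l≢j rewrite ≢⇒==-false i≢j = refl
      links : ∀ j′ l → j′ ≢ l → linked (lcAt i a (shapeOf (centred j c))) j′ l ≡ (j′ == j ∨ l == j)
      links j′ l j′≢l rewrite ≢⇒==-false i≢j with j′ == i | l == i
      ... | true  | _    = refl
      ... | false | true = refl
      ... | false | false with j′ == j in j′==j | l == j in l==j
      ...   | true  | true  = ⊥-elim (j′≢l (trans (==⇒≡ j′==j) (sym (==⇒≡ l==j))))
      ...   | true  | false = refl
      ...   | false | true  = refl
      ...   | false | false = refl

  lcShape-move : ∀ p → Canonical p → ∀ v → lcShape v (shapeOf p) ≅ shapeOf (move p v)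
  lcShape-move p canonical (i , a) with exposed (state (shapeOf p) i) a in a-exposed
  ... | false = ≅-refl
  ... | true  = exposedCase p canonical a-exposed
    where
    exposedCase : ∀ p → Canonical p → exposed (state (shapeOf p) i) a ≡ true →
                  lcAt i a (shapeOf p) ≅ shapeOf (moveExposed p i a)
    exposedCase (uncentred c) odd a-exposed = lcAt-uncentred c i a odd a-exposed
    exposedCase (centred j c) cj≡nothing a-exposed = byCentre (i ≟F j)
      where
      byCentre : (i≟j : Dec (i ≡ j)) → lcAt i a (shapeOf (centred j c)) ≅ shapeOf (moveCentred j c a i≟j)
      byCentre (yes refl) = lcAt-centred-centre i c a cj≡nothing
      byCentre (no  i≢j)  = lcAt-centred-other j c a i≢j
        (subst (λ s → exposed s a ≡ true) (state-centred-other c i≢j) a-exposed)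

  move-canonical : ∀ p → Canonical p → ∀ v → Canonical (move p v)
  move-canonical p canonical (i , a) with exposed (state (shapeOf p) i) a
  ... | false = canonical
  ... | true  = exposedCase p canonical
    where
    exposedCase : ∀ p → Canonical p → Canonical (moveExposed p i a)
    exposedCase (uncentred c) odd = []≔-updated c i nothing
    exposedCase (centred j c) cj≡nothing = byCentre (i ≟F j)
      where
      byCentre : (i≟j : Dec (i ≡ j)) → Canonical (moveCentred j c a i≟j)
      byCentre (no  i≢j)  = trans ([]≔-other c i (toggle a (c i)) (i≢j ∘ sym)) cj≡nothing
      byCentre (yes refl) with parityOf c in odd
      ... | true  = odd
      ... | false rewrite parityOf-update c i (just a) | odd | cj≡nothing = refl

  graphOf-move : ∀ p → Canonical p → ∀ v → lc eqV v (graphOf p) ≐ graphOf (move p v)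
  graphOf-move p canonical v =
    ≐-trans (⟦⟧-lc (shapeOf p) (shapeOf-symmetric p) v) (⟦⟧-cong (lcShape-move p canonical v))

  -- Reachability

  module Orbit (r : Fin k) (point : (i : Fin k) → Fin (n i)) where

    G₀ : Graph V
    G₀ = cliqueStar k n r

    start : Label
    start = centred r (λ _ → nothing)

    G₀≐start : G₀ ≐ graphOf start
    G₀≐start (i , a) (j , b) with i ≟F j
    ... | yes refl rewrite centreState-none {n i} with i == r
    ...   | true  = refl
    ...   | false = refl
    G₀≐start (i , a) (j , b) | no _ rewrite centreState-none {n i} | centreState-none {n j} with i == r | j == r
    ...   | true  | true  = refl
    ...   | true  | false = refl
    ...   | false | true  = refl
    ...   | false | false = refl

    orbit-labelled : ∀ {H} → Reachable eqV G₀ H → Σ Label λ p → Canonical p × H ≐ graphOf p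
    orbit-labelled here = start , refl , G₀≐start
    orbit-labelled (step reach v) with orbit-labelled reach
    ... | p , canonical , H≐p =
      move p v , move-canonical p canonical v , ≐-trans (lc-cong eqV H≐p v) (graphOf-move p canonical v)

    Reached : Label → Set
    Reached = Realised eqV G₀ graphOf

    reached-move : ∀ {p} → Canonical p → Reached p → ∀ v → Reached (move p v)
    reached-move canonical (H , reach , H≐p) v =
      lc eqV v H , step reach v , ≐-trans (lc-cong eqV H≐p v) (graphOf-move _ canonical v)

    reached-≈ : ∀ {p q} → p ≈ q → Reached p → Reached q
    reached-≈ p≈q (H , reach , H≐p) = H , reach , ≐-trans H≐p (⟦⟧-cong (≈⇒≅ _ _ p≈q))

    reached-mark : ∀ d {i} (x : Fin (n i)) → d r ≡ nothing → i ≢ r → d i ≡ nothing →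
                   Reached (centred r d) → Reached (centred r (d [ i ]≔ just x))
    reached-mark d {i} x dr≡nothing i≢r di≡nothing reached =
      reached-≈ (moved (i ≟F r))
        (subst Reached (move-exposed (centred r d) x-exposed) (reached-move {centred r d} dr≡nothing reached (i , x)))
      where
      x-exposed : exposed (state (shapeOf (centred r d)) i) x ≡ true
      x-exposed rewrite state-centred-other d i≢r | di≡nothing = refl
      moved : (i≟r : Dec (i ≡ r)) → moveCentred r d x i≟r ≈ centred r (d [ i ]≔ just x)
      moved (yes i≡r) = ⊥-elim (i≢r i≡r)
      moved (no  _)   = refl , λ l → cong (λ y → (d [ i ]≔ y) l) (cong (toggle x) di≡nothing)

    -- Induction on a list containing the marked cliques, marking one clique per move.
    reached-centred-r : ∀ is d → d r ≡ nothing → (∀ i → d i ≢ nothing → i ∈ is) →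
                        Reached (centred r d)
    reached-centred-r [] d dr≡nothing support =
      reached-≈ (refl , λ i → sym (unmarked i)) (G₀ , here , G₀≐start)
      where
      unmarked : ∀ i → d i ≡ nothing
      unmarked i with d i in di
      ... | nothing = refl
      ... | just _ with () ← support i (λ di≡nothing → case trans (sym di) di≡nothing of λ ())
    reached-centred-r (i ∷ is) d dr≡nothing support with d i in di
    ... | nothing = reached-centred-r is d dr≡nothing support′
      where
      support′ : ∀ l → d l ≢ nothing → l ∈ is
      support′ l dl≢nothing with support l dl≢nothing
      ... | here refl = ⊥-elim (dl≢nothing di)
      ... | there l∈is = l∈is
    ... | just x = reached-≈ (refl , []≔-agree (sym di) (λ l l≢i → []≔-other d i nothing l≢i))
        (reached-mark d′ x (trans ([]≔-other d i nothing (i≢r ∘ sym)) dr≡nothing) i≢r ([]≔-updated d i nothing)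
          (reached-centred-r is d′ (trans ([]≔-other d i nothing (i≢r ∘ sym)) dr≡nothing) support′))
      where
      d′ = d [ i ]≔ nothing
      i≢r : i ≢ r
      i≢r refl with () ← trans (sym di) dr≡nothing
      support′ : ∀ l → d′ l ≢ nothing → l ∈ is
      support′ l d′l≢nothing = byClique (l ≟F i)
        where
        byClique : Dec (l ≡ i) → l ∈ is
        byClique (yes refl) = ⊥-elim (d′l≢nothing ([]≔-updated d l nothing))
        byClique (no  l≢i)  with support l (subst (_≢ nothing) ([]≔-other d i nothing l≢i) d′l≢nothing)
        ... | here l≡i   = ⊥-elim (l≢i l≡i)
        ... | there l∈is = l∈is

    -- One move at the centre r, starting from c centred at r with the mark of r removed.
    reached-uncentred : ∀ c → parityOf c ≡ true → Reached (uncentred c)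
    reached-uncentred c odd =
      reached-≈ (moved (r ≟F r)) (subst Reached (move-exposed (centred r d) centre-exposed)
        (reached-move {centred r d} ([]≔-updated c r nothing) reached-d (r , a)))
      where
      d = c [ r ]≔ nothing
      a = fromMaybe (point r) (c r)
      centre-exposed : exposed (state (shapeOf (centred r d)) r) a ≡ true
      centre-exposed = subst (λ s → exposed s a ≡ true) (sym (state-centred-centre r d)) (exposed-centreState d a)
      reached-d : Reached (centred r d)
      reached-d = reached-centred-r (allFin k) d ([]≔-updated c r nothing) (λ i _ → ∈-allFin i)
      moved : (r≟r : Dec (r ≡ r)) → moveCentred r d a r≟r ≈ uncentred c
      moved (no r≢r) = ⊥-elim (r≢r refl)
      moved (yes refl) rewrite parityOf-update c r nothing | odd with c r in cr
      ... | nothing = []≔-agree {f = c} {g = c} (sym cr) (λ _ _ → refl)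
      ... | just x  = []≔-agree {f = d} {g = c} (sym cr) (λ l l≢r → []≔-other c r nothing l≢r)

    -- One move at clique j, starting from c made odd by marking j if necessary.
    reached-centred : ∀ j c → c j ≡ nothing → Reached (centred j c)
    reached-centred j c cj≡nothing =
      reached-≈ (refl , []≔-agree (sym cj≡nothing) (λ l l≢j → e-agrees l l≢j))
        (subst Reached (move-exposed (uncentred e) (a-exposed (parityOf c) refl))
          (reached-move {uncentred e} e-odd (reached-uncentred e e-odd) (j , point j)))
      where
      e = if parityOf c then c else c [ j ]≔ just (point j)
      e-agrees : ∀ l → l ≢ j → e l ≡ c l
      e-agrees l l≢j with parityOf c
      ... | true  = refl
      ... | false = []≔-other c j (just (point j)) l≢j
      e-odd : parityOf e ≡ true
      e-odd with parityOf c in odd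
      ... | true  = odd
      ... | false rewrite parityOf-update c j (just (point j)) | odd | cj≡nothing = refl
      a-exposed : ∀ b → parityOf c ≡ b →
                  exposed (pointed empty ((if b then c else c [ j ]≔ just (point j)) j)) (point j) ≡ true
      a-exposed true  _ rewrite cj≡nothing = refl
      a-exposed false _ rewrite []≔-updated c j (just (point j)) = ==-refl (point j)

    reached : ∀ {p} → Canonical p → Reached p
    reached {uncentred c} odd       = reached-uncentred c odd
    reached {centred j c} cj≡nothing = reached-centred j c cj≡nothing

  -- Distinguishing labels

  module Injectivity (point : (i : Fin k) → Fin (n i))
                     (another : ∀ i (x : Fin (n i)) → Σ (Fin (n i)) (_≢ x))
                     (third : (j j′ : Fin k) → Σ (Fin k) λ l → l ≢ j × l ≢ j′) where

    mark : ∀ {i} → Maybe (Fin (n i)) → Fin (n i)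
    mark {i} = fromMaybe (point i)

    exposedBy-mark : ∀ {i} (x : Maybe (Fin (n i))) → exposedBy x (mark x) ≡ true
    exposedBy-mark nothing  = refl
    exposedBy-mark (just x) = ==-refl x

    Separates : ∀ {m} → Maybe (Fin m) → Maybe (Fin m) → Fin m → Set
    Separates x y z = exposedBy x z ≡ true × exposedBy y z ≡ false

    separate : ∀ {i} {x y : Maybe (Fin (n i))} → x ≢ y → Σ _ (Separates x y) ⊎ Σ _ (Separates y x)
    separate {x = nothing} {nothing} x≢y = ⊥-elim (x≢y refl)
    separate {i} {nothing} {just y} _ with another i y
    ... | z , z≢y = inj₁ (z , refl , ≢⇒==-false z≢y)
    separate {i} {just x} {nothing} _ with another i x
    ... | z , z≢x = inj₂ (z , refl , ≢⇒==-false z≢x)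
    separate {x = just x} {just y} x≢y = inj₁ (x , ==-refl x , ≢⇒==-false (x≢y ∘ cong just))

    uncentred-separated : ∀ c c′ i z → Separates (c i) (c′ i) z →
                          ¬ graphOf (uncentred c) ≐ graphOf (uncentred c′)
    uncentred-separated c c′ i z (z-in , z-out) with third i i
    ... | l , l≢i , _ = separatedBy (i , z) (l , mark (c l)) edge no-edge
      where
      edge : graphOf (uncentred c) (i , z) (l , mark (c l)) ≡ true
      edge rewrite ⟦⟧-across (shapeOf (uncentred c)) z (mark (c l)) (l≢i ∘ sym)
                 | exposed-pointed-empty (c i) z | exposed-pointed-empty (c l) (mark (c l))
                 | z-in | exposedBy-mark (c l) = refl
      no-edge : graphOf (uncentred c′) (i , z) (l , mark (c l)) ≡ false
      no-edge rewrite ⟦⟧-across (shapeOf (uncentred c′)) z (mark (c l)) (l≢i ∘ sym)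
                    | exposed-pointed-empty (c′ i) z | z-out = refl

    uncentred≉centred : ∀ c j c′ → ¬ graphOf (uncentred c) ≐ graphOf (centred j c′)
    uncentred≉centred c j c′ with third j j
    ... | l , l≢j , _ with third j l
    ...   | m , m≢j , m≢l = separatedBy (l , mark (c l)) (m , mark (c m)) edge no-edge
      where
      edge : graphOf (uncentred c) (l , mark (c l)) (m , mark (c m)) ≡ true
      edge rewrite ⟦⟧-across (shapeOf (uncentred c)) (mark (c l)) (mark (c m)) (m≢l ∘ sym)
                 | exposed-pointed-empty (c l) (mark (c l)) | exposed-pointed-empty (c m) (mark (c m))
                 | exposedBy-mark (c l) | exposedBy-mark (c m) = refl
      no-edge : graphOf (centred j c′) (l , mark (c l)) (m , mark (c m)) ≡ false
      no-edge rewrite ⟦⟧-across (shapeOf (centred j c′)) (mark (c l)) (mark (c m)) (m≢l ∘ sym)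
                    | ≢⇒==-false l≢j | ≢⇒==-false m≢j = refl

    centred-centres : ∀ j c j′ c′ → j ≢ j′ → ¬ graphOf (centred j′ c′) ≐ graphOf (centred j c)
    centred-centres j c j′ c′ j≢j′ with third j j′
    ... | m , m≢j , m≢j′ = separatedBy (j′ , point j′) (m , mark (c′ m)) edge no-edge
      where
      edge : graphOf (centred j′ c′) (j′ , point j′) (m , mark (c′ m)) ≡ true
      edge rewrite ⟦⟧-across (shapeOf (centred j′ c′)) (point j′) (mark (c′ m)) (m≢j′ ∘ sym)
                 | state-centred-centre j′ c′ | state-centred-other c′ m≢j′ | ==-refl j′
                 | exposed-centreState c′ (point j′)
                 | exposed-pointed-complete (c′ m) (mark (c′ m)) | exposedBy-mark (c′ m) = refl
      no-edge : graphOf (centred j c) (j′ , point j′) (m , mark (c′ m)) ≡ false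
      no-edge rewrite ⟦⟧-across (shapeOf (centred j c)) (point j′) (mark (c′ m)) (m≢j′ ∘ sym)
                    | ≢⇒==-false (j≢j′ ∘ sym) | ≢⇒==-false m≢j = refl

    centred-separated : ∀ j c c′ {i} z → i ≢ j → Separates (c i) (c′ i) z →
                        ¬ graphOf (centred j c) ≐ graphOf (centred j c′)
    centred-separated j c c′ {i} z i≢j (z-in , z-out) = separatedBy (i , z) (j , point j) edge no-edge
      where
      edge : graphOf (centred j c) (i , z) (j , point j) ≡ true
      edge rewrite ⟦⟧-across (shapeOf (centred j c)) z (point j) i≢j
                 | state-centred-other c i≢j | state-centred-centre j c | ==-refl j
                 | exposed-pointed-complete (c i) z | z-in | exposed-centreState c (point j)
                 | ∨-zeroʳ (i == j) = refl
      no-edge : graphOf (centred j c′) (i , z) (j , point j) ≡ false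
      no-edge rewrite ⟦⟧-across (shapeOf (centred j c′)) z (point j) i≢j
                    | state-centred-other c′ i≢j | exposed-pointed-complete (c′ i) z | z-out
                    | ∧-zeroʳ (i == j ∨ j == j) = refl

    graphOf-injective : ∀ p q → Canonical p → Canonical q → graphOf p ≐ graphOf q → p ≈ q
    graphOf-injective (uncentred c) (uncentred c′) _ _ p≐q i with ≡-dec _≟F_ (c i) (c′ i)
    ... | yes ci≡c′i = ci≡c′i
    ... | no  ci≢c′i with separate ci≢c′i
    ...   | inj₁ (z , sep) = ⊥-elim (uncentred-separated c c′ i z sep p≐q)
    ...   | inj₂ (z , sep) = ⊥-elim (uncentred-separated c′ c i z sep (≐-sym p≐q))
    graphOf-injective (uncentred c) (centred j c′) _ _ p≐q = uncentred≉centred c j c′ p≐q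
    graphOf-injective (centred j c) (uncentred c′) _ _ p≐q = uncentred≉centred c′ j c (≐-sym p≐q)
    graphOf-injective (centred j c) (centred j′ c′) cj≡nothing c′j′≡nothing p≐q with j ≟F j′
    ... | no  j≢j′ = ⊥-elim (centred-centres j′ c′ j c (j≢j′ ∘ sym) p≐q)
    ... | yes refl = refl , agree
      where
      agree : c ≋ c′
      agree i with i ≟F j
      ... | yes refl = trans cj≡nothing (sym c′j′≡nothing)
      ... | no  i≢j  with ≡-dec _≟F_ (c i) (c′ i)
      ...   | yes ci≡c′i = ci≡c′i
      ...   | no  ci≢c′i with separate ci≢c′i
      ...     | inj₁ (z , sep) = ⊥-elim (centred-separated j c c′ z i≢j sep p≐q)
      ...     | inj₂ (z , sep) = ⊥-elim (centred-separated j c′ c z i≢j sep (≐-sym p≐q))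

  -- Counting labels

  marks : ∀ m → List (Maybe (Fin m))
  marks m = map just (allFin m)

  marks-unique : ∀ m → AllPairs _≢_ (marks m)
  marks-unique m = AllPairsP.map⁺ (AllPairs.map (λ x≢y → x≢y ∘ just-injective) (allFin⁺ m))

  uncentredOptions : Subset k → (i : Fin k) → List (Maybe (Fin (n i)))
  uncentredOptions I i = if lookup I i then marks (n i) else [ nothing ]

  centredOptions : Fin k → (i : Fin k) → List (Maybe (Fin (n i)))
  centredOptions j i = if i == j then [ nothing ] else nothing ∷ marks (n i)

  uncentredLabels : Subset k → List Label
  uncentredLabels I = map uncentred (choices (uncentredOptions I))

  centredLabels : Fin k → List Label
  centredLabels j = map (centred j) (choices (centredOptions j))

  oddSubsets : List (Subset k)
  oddSubsets = filter (λ I → T? (isOdd ∣ I ∣)) (allSubsets k)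

  labels : List Label
  labels = concatMap uncentredLabels oddSubsets ++ concatMap centredLabels (allFin k)

  uncentredOptions-support : ∀ I i {x} → x ∈ uncentredOptions I i → is-just x ≡ lookup I i
  uncentredOptions-support I i x∈ with lookup I i
  ... | true  with ∈-map⁻ just x∈
  ...   | _ , _ , refl = refl
  uncentredOptions-support I i (here refl) | false = refl

  uncentredOptions-unique : ∀ I i → AllPairs _≢_ (uncentredOptions I i)
  uncentredOptions-unique I i with lookup I i
  ... | true  = marks-unique (n i)
  ... | false = [] ∷ []

  centredOptions-unique : ∀ j i → AllPairs _≢_ (centredOptions j i)
  centredOptions-unique j i with i == j
  ... | true  = [] ∷ []
  ... | false = AllP.map⁺ (All.universal (λ _ ()) (allFin (n i))) ∷ marks-unique (n i)

  support : Pointing → Subset k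
  support c = Vec.tabulate (is-just ∘ c)

  support-uncentredOptions : ∀ I {c} → (∀ i → c i ∈ uncentredOptions I i) → support c ≡ I
  support-uncentredOptions I c∈ =
    trans (VecP.tabulate-cong (λ i → uncentredOptions-support I i (c∈ i))) (VecP.tabulate∘lookup I)

  parityOf-support : ∀ c → isOdd ∣ support c ∣ ≡ parityOf c
  parityOf-support c = trans (sym (parity-lookup (support c))) (parity-cong (VecP.lookup∘tabulate (is-just ∘ c)))

  uncentredOptions-odd : ∀ {I c} → I ∈ oddSubsets → (∀ i → c i ∈ uncentredOptions I i) → parityOf c ≡ true
  uncentredOptions-odd {I} {c} I∈ c∈ = begin
    parityOf c           ≡⟨ parityOf-support c ⟨
    isOdd ∣ support c ∣  ≡⟨ cong (λ J → isOdd ∣ J ∣) (support-uncentredOptions I c∈) ⟩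
    isOdd ∣ I ∣          ≡⟨ Equivalence.to T-≡ (proj₂ (∈-filter⁻ (λ I → T? (isOdd ∣ I ∣)) {xs = allSubsets k} I∈)) ⟩
    true                 ∎
    where open ≡-Reasoning

  centredOptions-centre : ∀ {j} {x : Maybe (Fin (n j))} → x ∈ centredOptions j j → x ≡ nothing
  centredOptions-centre {j} x∈ rewrite ==-refl j with x∈
  ... | here x≡nothing = x≡nothing

  labels-canonical : All Canonical labels
  labels-canonical = AllP.++⁺
    (All-concatMap⁺ uncentredLabels {oddSubsets} λ {I} I∈ →
       AllP.map⁺ (All.map (uncentredOptions-odd I∈) (choices-sound (uncentredOptions I))))
    (All-concatMap⁺ centredLabels {allFin k} λ {j} _ →
       AllP.map⁺ (All.map (λ c∈ → centredOptions-centre (c∈ j)) (choices-sound (centredOptions j))))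

  uncentredLabels-apart : ∀ {I J} → I ≢ J →
                          All (λ p → All (λ q → ¬ p ≈ q) (uncentredLabels J)) (uncentredLabels I)
  uncentredLabels-apart {I} {J} I≢J = AllP.map⁺ (All.map (λ c∈ → AllP.map⁺ (All.map (λ c′∈ c≋c′ →
      I≢J (trans (sym (support-uncentredOptions I c∈))
                 (trans (VecP.tabulate-cong (cong is-just ∘ c≋c′)) (support-uncentredOptions J c′∈))))
    (choices-sound (uncentredOptions J)))) (choices-sound (uncentredOptions I)))

  labels-distinct : AllPairs (λ p q → ¬ p ≈ q) labels
  labels-distinct = AllPairsP.++⁺ uncentred-distinct centred-distinct uncentred-apart
    where
    uncentred-distinct : AllPairs (λ p q → ¬ p ≈ q) (concatMap uncentredLabels oddSubsets)
    uncentred-distinct = AllPairs-concatMap⁺ uncentredLabels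
      (λ I → AllPairsP.map⁺ (choices-unique _ (uncentredOptions-unique I)))
      uncentredLabels-apart
      (AllPairsP.filter⁺ _ (allSubsets-unique k))
    centred-distinct : AllPairs (λ p q → ¬ p ≈ q) (concatMap centredLabels (allFin k))
    centred-distinct = AllPairs-concatMap⁺ centredLabels
      (λ j → AllPairsP.map⁺ (AllPairs.map (λ c≉c′ (_ , c≋c′) → c≉c′ c≋c′)
                                          (choices-unique _ (centredOptions-unique j))))
      (λ j≢j′ → AllP.map⁺ (All.universal (λ _ →
                  AllP.map⁺ (All.universal (λ _ (j≡j′ , _) → j≢j′ j≡j′) _)) _))
      (allFin⁺ k)
    uncentred-apart : All (λ p → All (λ q → ¬ p ≈ q) (concatMap centredLabels (allFin k)))
                          (concatMap uncentredLabels oddSubsets)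
    uncentred-apart = All-concatMap⁺ uncentredLabels {oddSubsets} λ _ → AllP.map⁺ (All.universal (λ _ →
      All-concatMap⁺ centredLabels {allFin k} λ _ → AllP.map⁺ (All.universal (λ _ ()) _)) _)

  labels-complete : ∀ p → Canonical p → Any (p ≈_) labels
  labels-complete (uncentred c) odd = AnyP.++⁺ˡ (AnyP.concatMap⁺ uncentredLabels
    (Any.map (λ { refl → AnyP.map⁺ (choices-complete _ c c∈) }) support∈))
    where
    support∈ : support c ∈ oddSubsets
    support∈ = ∈-filter⁺ (λ I → T? (isOdd ∣ I ∣)) (allSubsets-complete (support c))
                          (Equivalence.from T-≡ (trans (parityOf-support c) odd))
    c∈ : ∀ i → c i ∈ uncentredOptions (support c) i
    c∈ i rewrite VecP.lookup∘tabulate (is-just ∘ c) i with c i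
    ... | nothing = here refl
    ... | just x  = ∈-map⁺ just (∈-allFin x)
  labels-complete (centred j c) cj≡nothing = AnyP.++⁺ʳ _ (AnyP.concatMap⁺ centredLabels
    (Any.map (λ { refl → AnyP.map⁺ (Any.map (refl ,_) (choices-complete _ c c∈)) }) (∈-allFin j)))
    where
    c∈ : ∀ i → c i ∈ centredOptions j i
    c∈ i with i ≟F j
    ... | yes refl = here cj≡nothing
    ... | no  _    with c i
    ...   | nothing = here refl
    ...   | just x  = there (∈-map⁺ just (∈-allFin x))

  length-marks : ∀ m → length (marks m) ≡ m
  length-marks m = trans (length-map just (allFin m)) (length-tabulate id)

  length-uncentredLabels : ∀ I → length (uncentredLabels I) ≡ prodSubset k n I
  length-uncentredLabels I =
    trans (length-map uncentred (choices (uncentredOptions I)))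
          (trans (length-choices (uncentredOptions I)) (prodFin-cong length-options))
    where
    length-options : ∀ i → length (uncentredOptions I i) ≡ (if lookup I i then n i else 1)
    length-options i with lookup I i
    ... | true  = length-marks (n i)
    ... | false = refl

  length-centredLabels : ∀ j → length (centredLabels j) ≡ prodFin k (λ i → if i == j then 1 else suc (n i))
  length-centredLabels j =
    trans (length-map (centred j) (choices (centredOptions j)))
          (trans (length-choices (centredOptions j)) (prodFin-cong length-options))
    where
    length-options : ∀ i → length (centredOptions j i) ≡ (if i == j then 1 else suc (n i))
    length-options i with i == j
    ... | true  = refl
    ... | false = cong suc (length-marks (n i))

  length-labels : length labels ≡ oddSubsetSum k n + leaveOneOut k n
  length-labels = begin
    length labels
      ≡⟨ length-++ (concatMap uncentredLabels oddSubsets) ⟩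
    length (concatMap uncentredLabels oddSubsets) + length (concatMap centredLabels (allFin k))
      ≡⟨ cong₂ _+_ (length-concatMap uncentredLabels oddSubsets) (length-concatMap centredLabels (allFin k)) ⟩
    sumList (map (length ∘ uncentredLabels) oddSubsets) + sumList (map (length ∘ centredLabels) (allFin k))
      ≡⟨ cong₂ _+_ (cong sumList (map-cong length-uncentredLabels oddSubsets))
                   (cong sumList (trans (map-cong length-centredLabels (allFin k)) (map-tabulate id _))) ⟩
    oddSubsetSum k n + sumList (tabulate (λ j → prodFin k (λ i → if i == j then 1 else suc (n i))))
      ≡⟨ cong (oddSubsetSum k n +_) (sumList-tabulate (λ j → prodFin k λ i → if i == j then 1 else suc (n i))) ⟩
    oddSubsetSum k n + leaveOneOut k n ∎
    where open ≡-Reasoning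

  orbitSize : (r : Fin k) (point : (i : Fin k) → Fin (n i))
              (another : ∀ i (x : Fin (n i)) → Σ (Fin (n i)) (_≢ x))
              (third : (j j′ : Fin k) → Σ (Fin k) λ l → l ≢ j × l ≢ j′) →
              OrbitSize eqV (cliqueStar k n r) (oddSubsetSum k n + leaveOneOut k n)
  orbitSize r point another third =
    subst (OrbitSize eqV G₀) length-labels
      (orbitSize-fromLabels eqV G₀ graphOf (All.map reached labels-canonical)
        (AllPairs-map-local labels-canonical (λ {p} {q} p-canonical q-canonical p≉q p≐q →
           p≉q (graphOf-injective p q p-canonical q-canonical p≐q)) labels-distinct)
        covered)
    where
    open Orbit r point
    open Injectivity point another third
    covered : ∀ H → Reachable eqV G₀ H → Any (λ p → H ≐ graphOf p) labels
    covered H reach with orbit-labelled reach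
    ... | p , canonical , H≐p =
      Any.map (λ {q} p≈q → ≐-trans H≐p (⟦⟧-cong (≈⇒≅ p q p≈q))) (labels-complete p canonical)

theorem8 : (k : ℕ) (n : Fin k → ℕ) (r : Fin k) →
    3 ≤ k → (∀ i → 2 ≤ n i) →
    OrbitSize (csEq k n) (cliqueStar k n r) (oddSubsetSum k n + leaveOneOut k n)
theorem8 k n r 3≤k 2≤n =
  CliqueStarOrbit.orbitSize k n r (λ i → fromℕ< (<⇒≤ (2≤n i))) (λ i → Fin-another (2≤n i)) (Fin-third 3≤k)
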